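{- There exist an Alexandroff space $B$ and sheaves $\mathcal F$, $\mathcal G$ over $B$ such that $\mathrm{Supp}\,\mathcal F=\mathrm{Supp}\,\mathcal G$, yet $\mathrm{Supp}\,\mathrm{Hom}(\mathcal F,\mathcal G)\neq B$.
   Context: An Alexandroff space is a topological space in which arbitrary intersections of open sets are open. A sheaf on $B$ is a local homeomorphism $\mathcal F\colon E\to B$; $\mathrm{Supp}\,\mathcal F=\mathcal F(E)$. $\mathrm{Hom}(\mathcal F,\mathcal G)$ is the sheafification of the presheaf assigning to each open $U$ the set of sheaf morphisms $\mathcal F|_U\to\mathcal G|_U$ (continuous maps of total spaces over $U$ commuting with projections); its support is the set of $b$ having an open neighborhood $U$ over which such a morphism exists. -}

module Defs where

open import Data.Product using (Σ; _×_; _,_; proj₁; proj₂; ∃)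
open import Data.Unit using (⊤)
open import Relation.Binary.PropositionalEquality using (_≡_)
open import Relation.Nullary using (¬_)

Subset : Set → Set₁
Subset X = X → Set

_⇔′_ : Set → Set → Set
A ⇔′ B = (A → B) × (B → A)

record Top (X : Set) : Set₁ where
  field
    Open      : Subset X → Set
    open-ext  : ∀ {U V : Subset X} → (∀ x → U x ⇔′ V x) → Open U → Open V
    open-univ : Open (λ _ → ⊤)
    open-∩    : ∀ {U V : Subset X} → Open U → Open V → Open (λ x → U x × V x)
    open-⋃    : ∀ {I : Set} (U : I → Subset X) → (∀ i → Open (U i))
                → Open (λ x → Σ I (λ i → U i x))
open Top public

IsAlexandroff : ∀ {X : Set} → Top X → Set₁
IsAlexandroff {X} τ = ∀ {I : Set} (U : I → Subset X) → (∀ i → Open τ (U i))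
                      → Open τ (λ x → ∀ i → U i x)

Sub : (X : Set) → Subset X → Set
Sub X S = Σ X S

SubOpen : ∀ {X : Set} → Top X → (S : Subset X) → Subset (Sub X S) → Set₁
SubOpen {X} τ S P = Σ (Subset X) λ W → Open τ W × (∀ p → P p ⇔′ W (proj₁ p))

Continuous : ∀ {X Y : Set} → (Subset X → Set₁) → (Subset Y → Set₁) → (X → Y) → Set₁
Continuous {X} {Y} OX OY f = ∀ (V : Subset Y) → OY V → OX (λ x → V (f x))

record Lift₁ (A : Set) : Set₁ where
  constructor lift₁
  field lower₁ : A

Opens₁ : ∀ {X : Set} → Top X → Subset X → Set₁
Opens₁ τ U = Lift₁ (Open τ U)

Image : ∀ {E B : Set} → (E → B) → Subset E → Subset B
Image {E} f V b = Σ E λ e → V e × f e ≡ b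

restrict : ∀ {E B : Set} (π : E → B) (V : Subset E) → Sub E V → Sub B (Image π V)
restrict π V (e , v) = π e , (e , v , Relation.Binary.PropositionalEquality.refl)

IsLocalHomeo : ∀ {E B : Set} → Top E → Top B → (E → B) → Set₁
IsLocalHomeo {E} {B} τE τB π =
  Continuous (Opens₁ τE) (Opens₁ τB) π ×
  (∀ e → Σ (Subset E) λ V → Open τE V × V e × Open τB (Image π V) ×
     Continuous (SubOpen τE V) (SubOpen τB (Image π V)) (restrict π V) ×
     Σ (Sub B (Image π V) → Sub E V) λ g →
       Continuous (SubOpen τB (Image π V)) (SubOpen τE V) g ×
       (∀ x → proj₁ (g (restrict π V x)) ≡ proj₁ x) ×
       (∀ y → proj₁ (restrict π V (g y)) ≡ proj₁ y))

record Sheaf {B : Set} (τB : Top B) : Set₁ where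
  field
    E    : Set
    τE   : Top E
    π    : E → B
    isLH : IsLocalHomeo τE τB π
open Sheaf public

Supp : ∀ {B : Set} {τB : Top B} → Sheaf τB → Subset B
Supp 𝓕 b = ∃ λ e → π 𝓕 e ≡ b

Mor : ∀ {B : Set} {τB : Top B} → Sheaf τB → Sheaf τB → Subset B → Set₁
Mor 𝓕 𝓖 U =
  Σ (Sub (E 𝓕) (λ e → U (π 𝓕 e)) → Sub (E 𝓖) (λ e → U (π 𝓖 e))) λ φ →
    Continuous (SubOpen (τE 𝓕) (λ e → U (π 𝓕 e))) (SubOpen (τE 𝓖) (λ e → U (π 𝓖 e))) φ ×
    (∀ x → π 𝓖 (proj₁ (φ x)) ≡ π 𝓕 (proj₁ x))

SuppHom : ∀ {B : Set} {τB : Top B} → Sheaf τB → Sheaf τB → B → Set₁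
SuppHom {τB = τB} 𝓕 𝓖 b = Σ (Subset _) λ U → Open τB U × U b × Mor 𝓕 𝓖 U

module Submission where

-- Every preorder ≤ on X gives an Alexandroff topology whose opens are the
-- up-sets, and for such topologies sheaves are easy to build and to analyse:
--   * a monotone map π : E → B of preorders along which every relation π x ≤ b
--     lifts uniquely to some x ≤ y over b (a discrete fibration) is a local
--     homeomorphism — the up-set ↑e is the required neighbourhood of e;
--   * a continuous map between subspaces of up-set topologies is monotone.
-- The example is the poset B = {w < s, t < q}: w lies below everything, and s, t
-- lie below q.  𝓕 has one point over each of s, t, q; 𝓖 has one point over each
-- of s, t and two over q, the germ over s continuing to q₁ and the germ over t to
-- q₂.  Both have support {s, t, q}.  An open neighbourhood of w is all of B, and a
-- morphism 𝓕 → 𝓖 over B is monotone, so it sends the point of 𝓕 over q above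
-- both the point over s and the point over t of 𝓖, i.e. to q₁ and to q₂ at once.
-- Hence w ∉ Supp Hom(𝓕, 𝓖).

open import Defs
open import Data.Product using (Σ; _×_; _,_; proj₁; proj₂)
open import Data.Unit using (⊤; tt)
open import Data.Empty using (⊥)
open import Function using (id)
open import Relation.Binary.PropositionalEquality using (_≡_; refl; sym; trans; subst)
open import Relation.Nullary using (¬_)

UpTop : (X : Set) → (X → X → Set) → Top X
UpTop X R = record
  { Open      = λ U → ∀ {x y} → R x y → U x → U y
  ; open-ext  = λ U⇔V U-open r v → proj₁ (U⇔V _) (U-open r (proj₂ (U⇔V _) v))
  ; open-univ = λ _ _ → tt
  ; open-∩    = λ U-open V-open r (u , v) → U-open r u , V-open r v
  ; open-⋃    = λ U U-open r (i , u) → i , U-open i r u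
  }

upTop-alexandroff : (X : Set) (R : X → X → Set) → IsAlexandroff (UpTop X R)
upTop-alexandroff X R U U-open r x∈⋂ i = U-open i r (x∈⋂ i)

open-around-bottom : ∀ {X : Set} {R : X → X → Set} {⊥X : X} → (∀ x → R ⊥X x)
                     → ∀ {U : Subset X} → Open (UpTop X R) U → U ⊥X → ∀ x → U x
open-around-bottom below U-open U⊥ x = U-open (below x) U⊥

-- A continuous map between subspaces of up-set topologies of preorders is
-- monotone: the preimage of the up-set of f a is open and contains a.
continuous-monotone :
  ∀ {X Y : Set} {R : X → X → Set} {Q : Y → Y → Set} {S : Subset X} {T : Subset Y}
  → (∀ {y} → Q y y) → (∀ {x y z} → Q x y → Q y z → Q x z)
  → (f : Sub X S → Sub Y T)
  → Continuous (SubOpen (UpTop X R) S) (SubOpen (UpTop Y Q) T) f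
  → ∀ a b → R (proj₁ a) (proj₁ b) → Q (proj₁ (f a)) (proj₁ (f b))
continuous-monotone {Q = Q} reflQ transQ f f-cont a b a≤b
  with f-cont (λ y → Q (proj₁ (f a)) (proj₁ y))
              (Q (proj₁ (f a)) , (λ r u → transQ u r) , λ _ → id , id)
... | W , W-open , preimage⇔W =
  proj₂ (preimage⇔W b) (W-open a≤b (proj₁ (preimage⇔W a) reflQ))

record IsDiscreteFibration {E B : Set} (_≤E_ : E → E → Set) (_≤B_ : B → B → Set)
                           (π : E → B) : Set where
  field
    monotone    : ∀ {x y} → x ≤E y → π x ≤B π y
    lift        : ∀ {x b} → π x ≤B b → Σ E λ y → x ≤E y × π y ≡ b
    lift-unique : ∀ {e x y} → e ≤E x → e ≤E y → π x ≡ π y → x ≡ y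

module DiscreteFibrationSheaf {E B : Set} (_≤E_ : E → E → Set) (_≤B_ : B → B → Set)
  (reflE : ∀ {x} → x ≤E x) (transE : ∀ {x y z} → x ≤E y → y ≤E z → x ≤E z)
  (π : E → B) (fib : IsDiscreteFibration _≤E_ _≤B_ π) where

  open IsDiscreteFibration fib

  upE : Top E
  upE = UpTop E _≤E_

  upB : Top B
  upB = UpTop B _≤B_

  preimage-open : ∀ {W : Subset B} → Open upB W → Open upE (λ x → W (π x))
  preimage-open W-open r w = W-open (monotone r) w

  image-open : ∀ {V : Subset E} → Open upE V → Open upB (Image π V)
  image-open V-open r (x , v , refl) with lift r
  ... | y , x≤y , πy≡b = y , V-open x≤y v , πy≡b

  ↑_ : E → Subset E
  (↑ e) x = e ≤E x

  ↑-open : ∀ e → Open upE (↑ e)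
  ↑-open e x≤y e≤x = transE e≤x x≤y

  restrict-continuous : ∀ e →
    Continuous (SubOpen upE (↑ e)) (SubOpen upB (Image π (↑ e))) (restrict π (↑ e))
  restrict-continuous e P (W , W-open , P⇔W) =
    (λ x → W (π x)) , preimage-open W-open , λ p → P⇔W (restrict π (↑ e) p)

  section : ∀ e → Sub B (Image π (↑ e)) → Sub E (↑ e)
  section e (b , x , e≤x , πx≡b) = x , e≤x

  -- The preimage of W ∩ ↑ e under the section is π(W ∩ ↑ e); it is well defined
  -- because the lift of e over a point of π(↑ e) is unique.
  section-continuous : ∀ e →
    Continuous (SubOpen upB (Image π (↑ e))) (SubOpen upE (↑ e)) (section e)
  section-continuous e Q (W , W-open , Q⇔W) =
    Image π (λ x → e ≤E x × W x) , image-open (λ r (e≤x , w) → transE e≤x r , W-open r w) ,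
    λ { (b , x , e≤x , πx≡b) →
          (λ q → x , (e≤x , proj₁ (Q⇔W (x , e≤x)) q) , πx≡b) ,
          λ { (x′ , (e≤x′ , w′) , πx′≡b) →
                proj₂ (Q⇔W (x , e≤x))
                      (subst W (lift-unique e≤x′ e≤x (trans πx′≡b (sym πx≡b))) w′) } }

  section-right-inverse : ∀ e y → proj₁ (restrict π (↑ e) (section e y)) ≡ proj₁ y
  section-right-inverse e (b , x , e≤x , πx≡b) = πx≡b

  isLocalHomeo : IsLocalHomeo upE upB π
  isLocalHomeo =
    (λ W (lift₁ W-open) → lift₁ (preimage-open W-open)) ,
    λ e → ↑ e , ↑-open e , reflE , image-open (↑-open e) , restrict-continuous e ,
          section e , section-continuous e , (λ _ → refl) , section-right-inverse e

  sheaf : Sheaf upB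
  sheaf = record { E = E ; τE = upE ; π = π ; isLH = isLocalHomeo }

data Base : Set where w s t q : Base

_≤_ : Base → Base → Set
w ≤ _ = ⊤
s ≤ s = ⊤
s ≤ q = ⊤
t ≤ t = ⊤
t ≤ q = ⊤
q ≤ q = ⊤
_ ≤ _ = ⊥

≤-refl : ∀ {b} → b ≤ b
≤-refl {w} = tt
≤-refl {s} = tt
≤-refl {t} = tt
≤-refl {q} = tt

≤-trans : ∀ {a b c} → a ≤ b → b ≤ c → a ≤ c
≤-trans {w} _ _ = tt
≤-trans {s} {s} _ b≤c = b≤c
≤-trans {s} {q} {q} _ _ = tt
≤-trans {t} {t} _ b≤c = b≤c
≤-trans {t} {q} {q} _ _ = tt
≤-trans {q} {q} _ b≤c = b≤c

τ : Top Base
τ = UpTop Base _≤_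

data EF : Set where fs ft fq : EF

πF : EF → Base
πF fs = s
πF ft = t
πF fq = q

_≤F_ : EF → EF → Set
x ≤F y = πF x ≤ πF y

πF-injective : ∀ {x y} → πF x ≡ πF y → x ≡ y
πF-injective {fs} {fs} _ = refl
πF-injective {ft} {ft} _ = refl
πF-injective {fq} {fq} _ = refl

liftF : ∀ {x b} → πF x ≤ b → Σ EF λ y → x ≤F y × πF y ≡ b
liftF {fs} {s} _ = fs , tt , refl
liftF {fs} {q} _ = fq , tt , refl
liftF {ft} {t} _ = ft , tt , refl
liftF {ft} {q} _ = fq , tt , refl
liftF {fq} {q} _ = fq , tt , refl

𝓕 : Sheaf τ
𝓕 = DiscreteFibrationSheaf.sheaf _≤F_ _≤_ (λ {x} → ≤-refl {πF x})
      (λ {x} {y} {z} → ≤-trans {πF x} {πF y} {πF z}) πF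
      record { monotone = id ; lift = λ {x} {b} → liftF {x} {b}
             ; lift-unique = λ _ _ → πF-injective }

data EG : Set where gs gt gq₁ gq₂ : EG

πG : EG → Base
πG gs  = s
πG gt  = t
πG gq₁ = q
πG gq₂ = q

_≤G_ : EG → EG → Set
gs  ≤G gs  = ⊤
gs  ≤G gq₁ = ⊤
gt  ≤G gt  = ⊤
gt  ≤G gq₂ = ⊤
gq₁ ≤G gq₁ = ⊤
gq₂ ≤G gq₂ = ⊤
_   ≤G _   = ⊥

≤G-refl : ∀ {x} → x ≤G x
≤G-refl {gs}  = tt
≤G-refl {gt}  = tt
≤G-refl {gq₁} = tt
≤G-refl {gq₂} = tt

≤G-trans : ∀ {x y z} → x ≤G y → y ≤G z → x ≤G z
≤G-trans {gs}  {gs}  _ y≤z = y≤z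
≤G-trans {gs}  {gq₁} {gq₁} _ _ = tt
≤G-trans {gt}  {gt}  _ y≤z = y≤z
≤G-trans {gt}  {gq₂} {gq₂} _ _ = tt
≤G-trans {gq₁} {gq₁} _ y≤z = y≤z
≤G-trans {gq₂} {gq₂} _ y≤z = y≤z

πG-monotone : ∀ {x y} → x ≤G y → πG x ≤ πG y
πG-monotone {gs}  {gs}  _ = tt
πG-monotone {gs}  {gq₁} _ = tt
πG-monotone {gt}  {gt}  _ = tt
πG-monotone {gt}  {gq₂} _ = tt
πG-monotone {gq₁} {gq₁} _ = tt
πG-monotone {gq₂} {gq₂} _ = tt

liftG : ∀ {x b} → πG x ≤ b → Σ EG λ y → x ≤G y × πG y ≡ b
liftG {gs}  {s} _ = gs  , tt , refl
liftG {gs}  {q} _ = gq₁ , tt , refl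
liftG {gt}  {t} _ = gt  , tt , refl
liftG {gt}  {q} _ = gq₂ , tt , refl
liftG {gq₁} {q} _ = gq₁ , tt , refl
liftG {gq₂} {q} _ = gq₂ , tt , refl

liftG-unique : ∀ {e x y} → e ≤G x → e ≤G y → πG x ≡ πG y → x ≡ y
liftG-unique {gs}  {gs}  {gs}  _ _ _ = refl
liftG-unique {gs}  {gq₁} {gq₁} _ _ _ = refl
liftG-unique {gt}  {gt}  {gt}  _ _ _ = refl
liftG-unique {gt}  {gq₂} {gq₂} _ _ _ = refl
liftG-unique {gq₁} {gq₁} {gq₁} _ _ _ = refl
liftG-unique {gq₂} {gq₂} {gq₂} _ _ _ = refl

𝓖 : Sheaf τ
𝓖 = DiscreteFibrationSheaf.sheaf _≤G_ _≤_ (λ {x} → ≤G-refl {x})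
      (λ {x} {y} {z} → ≤G-trans {x} {y} {z}) πG
      record { monotone = λ {x} {y} → πG-monotone {x} {y} ; lift = λ {x} {b} → liftG {x} {b}
             ; lift-unique = λ {e} {x} {y} → liftG-unique {e} {x} {y} }

same-support : ∀ b → Supp 𝓕 b ⇔′ Supp 𝓖 b
same-support b = to , from
  where
  to : Supp 𝓕 b → Supp 𝓖 b
  to (fs , πx≡b) = gs  , πx≡b
  to (ft , πx≡b) = gt  , πx≡b
  to (fq , πx≡b) = gq₁ , πx≡b
  from : Supp 𝓖 b → Supp 𝓕 b
  from (gs  , πx≡b) = fs , πx≡b
  from (gt  , πx≡b) = ft , πx≡b
  from (gq₁ , πx≡b) = fq , πx≡b
  from (gq₂ , πx≡b) = fq , πx≡b

no-common-germ-over-q : ∀ x y z → πG x ≡ s → πG y ≡ t → πG z ≡ q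
                        → x ≤G z → y ≤G z → ⊥
no-common-germ-over-q gs gt gq₁ _ _ _ _ ()
no-common-germ-over-q gs gt gq₂ _ _ _ () _

-- Hom(𝓕, 𝓖) has no section near w: an open U ∋ w is all of B, and a morphism
-- over B, being monotone, would map fq above the images of fs and ft.
no-hom-near-w : ¬ SuppHom 𝓕 𝓖 w
no-hom-near-w (U , U-open , U∋w , φ , φ-continuous , φ-over) =
  no-common-germ-over-q (image fs) (image ft) (image fq)
    (φ-over (at fs)) (φ-over (at ft)) (φ-over (at fq))
    (monotone (at fs) (at fq) tt) (monotone (at ft) (at fq) tt)
  where
  at : ∀ x → Sub EF (λ x → U (πF x))
  at x = x , open-around-bottom {R = _≤_} (λ _ → tt) U-open U∋w (πF x)
  image : EF → EG
  image x = proj₁ (φ (at x))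
  monotone : ∀ a b → proj₁ a ≤F proj₁ b → proj₁ (φ a) ≤G proj₁ (φ b)
  monotone = continuous-monotone {R = _≤F_} (λ {x} → ≤G-refl {x})
               (λ {x} {y} {z} → ≤G-trans {x} {y} {z}) φ φ-continuous

proposition6p12 :
    Σ Set λ B → Σ (Top B) λ τ → IsAlexandroff τ × Σ (Sheaf τ) λ 𝓕 → Σ (Sheaf τ) λ 𝓖 →
      (∀ b → Supp 𝓕 b ⇔′ Supp 𝓖 b) × ¬ (∀ b → SuppHom 𝓕 𝓖 b)
proposition6p12 =
  Base , τ , upTop-alexandroff Base _≤_ , 𝓕 , 𝓖 , same-support ,
  λ hom-everywhere → no-hom-near-w (hom-everywhere w)
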